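{- Starting with $(x_1,x_2)\in\mathbb{Z}^2$, the repeated application of $\mathcal{K}_1,\mathcal{K}_2,\mathcal{K}_1,\mathcal{K}_2,\dots$ generates cycles of length $6$. The orbits, each consisting of $1$ or $3$ points in degenerate cases and of $6$ distinct points otherwise, form a partition of $\mathbb{Z}^2$. Moreover: (i) the length (perimeter) of each orbit is divisible by $4$; (ii) for every odd integer $d\ge3$ and every $r\in\{0,1,\dots,d-1\}$ there exist orbits with perimeter congruent to $r\pmod d$; (iii) the bounding box of each orbit (the smallest axis-parallel rectangle containing it) is a square whose perimeter equals the perimeter of the orbit.
   Context: On $\mathbb{Z}^2$ let $\mathcal{K}_1(x_1,x_2)=(-x_1+x_2,x_2)$ and $\mathcal{K}_2(x_1,x_2)=(x_1,x_1-x_2)$. The orbit of $\mathbf{x}$ is the set of points obtained from $\mathbf{x}$ by alternately applying $\mathcal{K}_1$ and $\mathcal{K}_2$. Its length (perimeter) is the total length of the closed six-step path $\mathbf{x}\to\mathcal{K}_1\mathbf{x}\to\mathcal{K}_2\mathcal{K}_1\mathbf{x}\to\cdots\to\mathbf{x}$; consecutive steps are alternately horizontal and vertical, and some steps may have length $0$. This length equals $2(|2x_1-x_2|+|x_1+x_2|+|2x_2-x_1|)$. -}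

module Defs where

open import Data.Nat using (ℕ; zero; suc)
import Data.Nat as ℕ
open import Data.Integer using (ℤ; +_; _+_; _-_; -_; ∣_∣; _≤_)
open import Relation.Binary.PropositionalEquality using (_≡_)
open import Data.Product using (_×_; _,_; proj₁; proj₂; Σ; ∃; ∃-syntax)

Point : Set
Point = ℤ × ℤ

K₁ : Point → Point
K₁ (x₁ , x₂) = (- x₁ + x₂ , x₂)

K₂ : Point → Point
K₂ (x₁ , x₂) = (x₁ , x₁ - x₂)

mutual
  walk₁ : Point → ℕ → Point
  walk₁ x zero    = x
  walk₁ x (suc n) = walk₂ (K₁ x) n

  walk₂ : Point → ℕ → Point
  walk₂ x zero    = x
  walk₂ x (suc n) = walk₁ (K₂ x) n

_∈Orbit_ : Point → Point → Set
w ∈Orbit x = ∃[ n ] w ≡ walk₁ x n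

-- Length of a (horizontal or vertical) step between two points
-- (the L¹ distance, which is the Euclidean length for axis-parallel steps).
stepLength : Point → Point → ℕ
stepLength (a₁ , a₂) (b₁ , b₂) = ∣ b₁ - a₁ ∣ ℕ.+ ∣ b₂ - a₂ ∣

sumBelow : ℕ → (ℕ → ℕ) → ℕ
sumBelow zero    f = 0
sumBelow (suc n) f = sumBelow n f ℕ.+ f n

perimeter : Point → ℕ
perimeter x = sumBelow 6 (λ i → stepLength (walk₁ x i) (walk₁ x (suc i)))

IsBoundingBox : (Point → Set) → ℤ → ℤ → ℤ → ℤ → Set
IsBoundingBox S xmin xmax ymin ymax =
  (∀ p → S p → (xmin ≤ proj₁ p × proj₁ p ≤ xmax) × (ymin ≤ proj₂ p × proj₂ p ≤ ymax))
  × (∃[ p ] (S p × proj₁ p ≡ xmin)) × (∃[ p ] (S p × proj₁ p ≡ xmax))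
  × (∃[ p ] (S p × proj₂ p ≡ ymin)) × (∃[ p ] (S p × proj₂ p ≡ ymax))

{-# OPTIONS --safe #-}
module Submission where

-- Write a point as (u , - w) and put v = - u - w, so that u + v + w = 0: then K₁ swaps u and v,
-- and K₂ swaps v and w. The walk therefore visits the points (s , - t) for the six ordered pairs
-- (s , t) of distinct positions in the triple (u , v , w), so an orbit has 1, 3 or 6 points
-- according as the triple has 1, 2 or 3 distinct entries, its x-coordinates are u, v, w and its
-- y-coordinates - u, - v, - w. Each step of the closed path joins two of these points sharing a
-- coordinate, so the perimeter is 2 (|u - v| + |v - w| + |w - u|) = 4 (M - m), where m and M are
-- the least and the greatest entry, and the bounding box is the square [m , M] × [- M , - m].
-- Finally, the point (- n , 0) has perimeter 8 n, and 8 is invertible modulo every odd d.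

open import Defs
open import Data.Nat using (ℕ; _<_; _%_; _≤_) renaming (_*_ to _*ℕ_; _+_ to _+ℕ_)
open import Data.Integer using (ℤ; +_; _-_; _*_; _+_)
open import Data.Product using (_×_; _,_; ∃-syntax)
open import Data.Sum using (_⊎_)
open import Data.List using (List; length)
open import Data.List.Membership.Propositional using (_∈_)
open import Data.List.Relation.Unary.Unique.Propositional using (Unique)
open import Relation.Binary.PropositionalEquality using (_≡_)
open import Function.Bundles using (_⇔_)

open import Algebra.Properties.CommutativeSemigroup using (xy∙z≈xz∙y)
open import Data.Integer using (-_; -[1+_]; ∣_∣; 0ℤ)
import Data.Integer as ℤ using (_≤_; _≟_)
open import Data.Integer.Properties
  using (+-comm; +-commutativeSemigroup; +-identityʳ; +-inverseʳ; +-inverseˡ; neg-involutive;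
         neg-injective; neg-distrib-+; neg-mono-≤; ∣-i∣≡∣i∣; ∣i-j∣≡∣j-i∣; 0≤i⇒+∣i∣≡i; i≤j⇒0≤j-i;
         pos-+; pos-*; abs-*; ≤-total; ≤-refl; ≤-trans)
import Data.Integer.Tactic.RingSolver as ℤ-Solver
open import Data.List using ([]; _∷_; [_]; _++_; map; upTo; take; drop; foldl; zipWith)
open import Data.List.Membership.Propositional.Properties using (∈-map⁻)
open import Data.List.Properties using (∷-injectiveˡ)
open import Data.List.Relation.Binary.Pointwise using (Pointwise-≡⇒≡; []; _∷_)
open import Data.List.Relation.Unary.All as All using (All; []; _∷_)
open import Data.List.Relation.Unary.AllPairs using ([]; _∷_)
open import Data.List.Relation.Unary.Any using (here; there)
open import Data.Nat using (zero; suc; _/_)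
open import Data.Nat.DivMod using (m≡m%n+[m/n]*n)
import Data.Nat.Properties as ℕ
import Data.Nat.Tactic.RingSolver as ℕ-Solver
open import Data.Product using (proj₁; proj₂)
open import Data.Product.Properties using (,-injectiveˡ; ,-injectiveʳ)
open import Data.Sum using (inj₁; inj₂)
open import Function.Base using (id; _∘_)
open import Function.Bundles using (mk⇔; module Equivalence)
open import Function.Construct.Composition using (_⇔-∘_)
open import Function.Construct.Symmetry using (⇔-sym)
open import Relation.Binary.Definitions using (DecidableEquality)
open import Relation.Binary.PropositionalEquality
  using (refl; sym; trans; cong; cong₂; subst; _≢_; ≢-sym; module ≡-Reasoning)
open import Relation.Nullary using (yes; no)

open Equivalence using (to; from)
open ≡-Reasoning

module _ {a b} {A : Set a} {B : Set b} (_⊗_ : A → A → B) where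

  arrangements : A → A → A → List B
  arrangements u v w = u ⊗ w ∷ v ⊗ w ∷ v ⊗ u ∷ w ⊗ u ∷ w ⊗ v ∷ u ⊗ v ∷ []

  arrangements-All : ∀ {p q} {P : B → Set p} {Q : A → Set q} {u v w} →
                     (∀ {s t} → Q s → Q t → P (s ⊗ t)) →
                     All Q (u ∷ v ∷ w ∷ []) → All P (arrangements u v w)
  arrangements-All f (qu ∷ qv ∷ qw ∷ []) =
    f qu qw ∷ f qv qw ∷ f qv qu ∷ f qw qu ∷ f qw qv ∷ f qu qv ∷ []

  ∈-arrangementsˡ : ∀ {s u v w} → s ∈ u ∷ v ∷ w ∷ [] → ∃[ t ] s ⊗ t ∈ arrangements u v w
  ∈-arrangementsˡ (here refl)                 = _ , here refl
  ∈-arrangementsˡ (there (here refl))         = _ , there (here refl)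
  ∈-arrangementsˡ (there (there (here refl))) = _ , there (there (there (here refl)))

  ∈-arrangementsʳ : ∀ {t u v w} → t ∈ u ∷ v ∷ w ∷ [] → ∃[ s ] s ⊗ t ∈ arrangements u v w
  ∈-arrangementsʳ (here refl)                 = _ , there (there (here refl))
  ∈-arrangementsʳ (there (here refl))         = _ , there (there (there (there (here refl))))
  ∈-arrangementsʳ (there (there (here refl))) = _ , here refl

  module _ (_≟_ : DecidableEquality A)
           (⊗-injective : ∀ {s s′ t t′} → s ⊗ t ≡ s′ ⊗ t′ → s ≡ s′ × t ≡ t′) where

    private
      ≢ˡ : ∀ {s s′ t t′} → s ≢ s′ → s ⊗ t ≢ s′ ⊗ t′
      ≢ˡ s≢s′ = s≢s′ ∘ proj₁ ∘ ⊗-injective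

      ≢ʳ : ∀ {s s′ t t′} → t ≢ t′ → s ⊗ t ≢ s′ ⊗ t′
      ≢ʳ t≢t′ = t≢t′ ∘ proj₂ ∘ ⊗-injective

      sameElements : ∀ {xs ys : List B} → All (_∈ ys) xs → All (_∈ xs) ys → ∀ x → x ∈ xs ⇔ x ∈ ys
      sameElements xs⊆ys ys⊆xs x = mk⇔ (All.lookup xs⊆ys) (All.lookup ys⊆xs)

    arrangements-unique : ∀ {u v w} → u ≢ v → v ≢ w → w ≢ u → Unique (arrangements u v w)
    arrangements-unique u≢v v≢w w≢u =
      (≢ˡ u≢v ∷ ≢ˡ u≢v ∷ ≢ˡ u≢w ∷ ≢ˡ u≢w ∷ ≢ʳ w≢v ∷ []) ∷
      (≢ʳ w≢u ∷ ≢ˡ v≢w ∷ ≢ˡ v≢w ∷ ≢ˡ v≢u ∷ []) ∷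
      (≢ˡ v≢w ∷ ≢ˡ v≢w ∷ ≢ˡ v≢u ∷ []) ∷
      (≢ʳ u≢v ∷ ≢ˡ w≢u ∷ []) ∷
      (≢ˡ w≢u ∷ []) ∷ [] ∷ []
      where
      u≢w = ≢-sym w≢u
      v≢u = ≢-sym u≢v
      w≢v = ≢-sym v≢w

    arrangements-dedup : ∀ u v w → ∃[ L ] (Unique L × (∀ x → x ∈ arrangements u v w ⇔ x ∈ L)
                                           × (length L ≡ 1 ⊎ length L ≡ 3 ⊎ length L ≡ 6))
    arrangements-dedup u v w with u ≟ v | v ≟ w | w ≟ u
    ... | yes refl | yes refl | _ =
      [ u ⊗ u ] , [] ∷ [] ,
      sameElements (here refl ∷ here refl ∷ here refl ∷ here refl ∷ here refl ∷ here refl ∷ [])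
                   (here refl ∷ []) ,
      inj₁ refl
    ... | yes refl | no u≢w | _ =
      u ⊗ w ∷ u ⊗ u ∷ w ⊗ u ∷ [] ,
      (≢ʳ (≢-sym u≢w) ∷ ≢ˡ u≢w ∷ []) ∷ (≢ˡ u≢w ∷ []) ∷ [] ∷ [] ,
      sameElements (here refl ∷ here refl ∷ there (here refl) ∷ there (there (here refl))
                      ∷ there (there (here refl)) ∷ there (here refl) ∷ [])
                   (here refl ∷ there (there (here refl)) ∷ there (there (there (here refl))) ∷ []) ,
      inj₂ (inj₁ refl)
    ... | no u≢v | yes refl | _ =
      u ⊗ v ∷ v ⊗ v ∷ v ⊗ u ∷ [] ,
      (≢ˡ u≢v ∷ ≢ˡ u≢v ∷ []) ∷ (≢ʳ (≢-sym u≢v) ∷ []) ∷ [] ∷ [] ,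
      sameElements (here refl ∷ there (here refl) ∷ there (there (here refl))
                      ∷ there (there (here refl)) ∷ there (here refl) ∷ here refl ∷ [])
                   (here refl ∷ there (here refl) ∷ there (there (here refl)) ∷ []) ,
      inj₂ (inj₁ refl)
    ... | no u≢v | no _ | yes refl =
      u ⊗ u ∷ v ⊗ u ∷ u ⊗ v ∷ [] ,
      (≢ˡ u≢v ∷ ≢ʳ u≢v ∷ []) ∷ (≢ˡ (≢-sym u≢v) ∷ []) ∷ [] ∷ [] ,
      sameElements (here refl ∷ there (here refl) ∷ there (here refl) ∷ here refl
                      ∷ there (there (here refl)) ∷ there (there (here refl)) ∷ [])
                   (here refl ∷ there (here refl) ∷ there (there (there (there (here refl)))) ∷ []) ,
      inj₂ (inj₁ refl)
    ... | no u≢v | no v≢w | no w≢u =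
      arrangements u v w , arrangements-unique u≢v v≢w w≢u , (λ _ → mk⇔ id id) , inj₂ (inj₂ refl)

corner : ℤ → ℤ → Point
corner u w = (u , - w)

corner-injective : ∀ {s s′ t t′} → corner s t ≡ corner s′ t′ → s ≡ s′ × t ≡ t′
corner-injective e = ,-injectiveˡ e , neg-injective (,-injectiveʳ e)

record ZeroSum (u v w : ℤ) : Set where
  constructor zeroSum
  field sum≡0 : u + v + w ≡ 0ℤ

ZeroSum-swap₁₂ : ∀ {u v w} → ZeroSum u v w → ZeroSum v u w
ZeroSum-swap₁₂ {u} {v} {w} (zeroSum h) = zeroSum (trans (cong (_+ w) (+-comm v u)) h)

ZeroSum-swap₂₃ : ∀ {u v w} → ZeroSum u v w → ZeroSum u w v
ZeroSum-swap₂₃ {u} {v} {w} (zeroSum h) = zeroSum (trans (xy∙z≈xz∙y +-commutativeSemigroup u w v) h)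

ZeroSum-rotate : ∀ {u v w} → ZeroSum u v w → ZeroSum v w u
ZeroSum-rotate = ZeroSum-swap₂₃ ∘ ZeroSum-swap₁₂

ZeroSum⇒-u-w≡v : ∀ {u v w} → ZeroSum u v w → - u - w ≡ v
ZeroSum⇒-u-w≡v {u} {v} {w} (zeroSum h) = begin
  - u - w                ≡⟨ sym (+-identityʳ (- u - w)) ⟩
  - u - w + 0ℤ           ≡⟨ cong (_+_ (- u - w)) (sym h) ⟩
  - u - w + (u + v + w)  ≡⟨ cancel u v w ⟩
  v                      ∎
  where
  cancel : ∀ u v w → - u - w + (u + v + w) ≡ v
  cancel = ℤ-Solver.solve-∀

K₁-swap : ∀ {u v w} → ZeroSum u v w → K₁ (corner u w) ≡ corner v w
K₁-swap h = cong (_, _) (ZeroSum⇒-u-w≡v h)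

K₂-swap : ∀ {u v w} → ZeroSum u v w → K₂ (corner u w) ≡ corner u v
K₂-swap {u} {v} {w} h = cong (u ,_) (begin
  u - - w      ≡⟨ neg-sum u w ⟩
  - (- u - w)  ≡⟨ cong -_ (ZeroSum⇒-u-w≡v h) ⟩
  - v          ∎)
  where
  neg-sum : ∀ u w → u - - w ≡ - (- u - w)
  neg-sum = ℤ-Solver.solve-∀

data TripleView : Point → Set where
  triple : ∀ u v w → ZeroSum u v w → TripleView (corner u w)

tripleView : ∀ x → TripleView x
tripleView (a , b) =
  subst TripleView (cong (a ,_) (neg-involutive b)) (triple a (b - a) (- b) (zeroSum (sum≡0 a b)))
  where
  sum≡0 : ∀ a b → a + (b - a) + - b ≡ 0ℤ
  sum≡0 = ℤ-Solver.solve-∀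

K₁-involutive : ∀ x → K₁ (K₁ x) ≡ x
K₁-involutive x with tripleView x
... | triple u v w h = trans (cong K₁ (K₁-swap h)) (K₁-swap (ZeroSum-swap₁₂ h))

K₂-involutive : ∀ x → K₂ (K₂ x) ≡ x
K₂-involutive x with tripleView x
... | triple u v w h = trans (cong K₂ (K₂-swap h)) (K₂-swap (ZeroSum-swap₂₃ h))

walk₁-rotate : ∀ {u v w} → ZeroSum u v w → walk₁ (corner u w) 2 ≡ corner v u
walk₁-rotate h = trans (cong K₂ (K₁-swap h)) (K₂-swap (ZeroSum-swap₁₂ h))

walk₁-2+ : ∀ {u v w} → ZeroSum u v w → ∀ n → walk₁ (corner u w) (2 +ℕ n) ≡ walk₁ (corner v u) n
walk₁-2+ h n = cong (λ p → walk₁ p n) (walk₁-rotate h)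

hexagon : ℤ → ℤ → ℤ → List Point
hexagon u v w = arrangements corner u v w ++ [ corner u w ]

walk₁-hexagon : ∀ {u v w} → ZeroSum u v w → map (walk₁ (corner u w)) (upTo 7) ≡ hexagon u v w
walk₁-hexagon h = Pointwise-≡⇒≡
  ( refl
  ∷ K₁-swap h
  ∷ walk₁-rotate h
  ∷ trans (walk₁-2+ h 1) (K₁-swap h₁)
  ∷ trans (walk₁-2+ h 2) (walk₁-rotate h₁)
  ∷ trans (walk₁-2+ h 3) (trans (walk₁-2+ h₁ 1) (K₁-swap h₂))
  ∷ trans (walk₁-2+ h 4) (trans (walk₁-2+ h₁ 2) (walk₁-rotate h₂))
  ∷ [])
  where
  h₁ = ZeroSum-rotate h
  h₂ = ZeroSum-rotate h₁

walk₁-period : ∀ x → walk₁ x 6 ≡ x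
walk₁-period x with tripleView x
... | triple u v w h = ∷-injectiveˡ (cong (drop 6) (walk₁-hexagon h))

orbitList : Point → List Point
orbitList x = map (walk₁ x) (upTo 6)

walk₁∈orbitList : ∀ x n → walk₁ x n ∈ orbitList x
walk₁∈orbitList x 0 = here refl
walk₁∈orbitList x 1 = there (here refl)
walk₁∈orbitList x 2 = there (there (here refl))
walk₁∈orbitList x 3 = there (there (there (here refl)))
walk₁∈orbitList x 4 = there (there (there (there (here refl))))
walk₁∈orbitList x 5 = there (there (there (there (there (here refl)))))
walk₁∈orbitList x (suc (suc (suc (suc (suc (suc n)))))) =
  subst (_∈ orbitList x) (cong (λ y → walk₁ y n) (sym (walk₁-period x))) (walk₁∈orbitList x n)

∈Orbit⇔∈orbitList : ∀ x p → p ∈Orbit x ⇔ p ∈ orbitList x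
∈Orbit⇔∈orbitList x p = mk⇔ (λ { (n , refl) → walk₁∈orbitList x n })
                             (λ p∈ → let n , _ , p≡ = ∈-map⁻ (walk₁ x) {xs = upTo 6} p∈ in n , p≡)

K₁-∈orbitList : ∀ {x p} → p ∈ orbitList x → K₁ p ∈ orbitList x
K₁-∈orbitList (here refl)                                         = there (here refl)
K₁-∈orbitList (there (here refl))                                 = here (K₁-involutive _)
K₁-∈orbitList (there (there (here refl)))                         = there (there (there (here refl)))
K₁-∈orbitList (there (there (there (here refl))))                 = there (there (here (K₁-involutive _)))
K₁-∈orbitList (there (there (there (there (here refl)))))         = there (there (there (there (there (here refl)))))
K₁-∈orbitList (there (there (there (there (there (here refl)))))) = there (there (there (there (here (K₁-involutive _)))))

K₂-∈orbitList : ∀ {x p} → p ∈ orbitList x → K₂ p ∈ orbitList x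
K₂-∈orbitList {x} (here refl) = there (there (there (there (there (here (begin
  K₂ x                 ≡⟨ cong K₂ (sym (walk₁-period x)) ⟩
  K₂ (K₂ (walk₁ x 5))  ≡⟨ K₂-involutive (walk₁ x 5) ⟩
  walk₁ x 5            ∎))))))
K₂-∈orbitList (there (here refl))                                     = there (there (here refl))
K₂-∈orbitList (there (there (here refl)))                             = there (here (K₂-involutive _))
K₂-∈orbitList (there (there (there (here refl))))                     = there (there (there (there (here refl))))
K₂-∈orbitList (there (there (there (there (here refl)))))             = there (there (there (here (K₂-involutive _))))
K₂-∈orbitList {x} (there (there (there (there (there (here refl)))))) = here (walk₁-period x)

K₁-∈Orbit : ∀ {x p} → p ∈Orbit x → K₁ p ∈Orbit x
K₁-∈Orbit {x} {p} = from (∈Orbit⇔∈orbitList x (K₁ p)) ∘ K₁-∈orbitList ∘ to (∈Orbit⇔∈orbitList x p)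

K₂-∈Orbit : ∀ {x p} → p ∈Orbit x → K₂ p ∈Orbit x
K₂-∈Orbit {x} {p} = from (∈Orbit⇔∈orbitList x (K₂ p)) ∘ K₂-∈orbitList ∘ to (∈Orbit⇔∈orbitList x p)

mutual
  walk₁-∈Orbit : ∀ {x p} → p ∈Orbit x → ∀ n → walk₁ p n ∈Orbit x
  walk₁-∈Orbit p∈ zero    = p∈
  walk₁-∈Orbit p∈ (suc n) = walk₂-∈Orbit (K₁-∈Orbit p∈) n

  walk₂-∈Orbit : ∀ {x p} → p ∈Orbit x → ∀ n → walk₂ p n ∈Orbit x
  walk₂-∈Orbit p∈ zero    = p∈
  walk₂-∈Orbit p∈ (suc n) = walk₁-∈Orbit (K₂-∈Orbit p∈) n

∈Orbit-trans : ∀ {x y z} → x ∈Orbit y → y ∈Orbit z → x ∈Orbit z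
∈Orbit-trans (n , refl) y∈ = walk₁-∈Orbit y∈ n

mutual
  ∈Orbit-walk₁ : ∀ x n → x ∈Orbit walk₁ x n
  ∈Orbit-walk₁ x zero    = 0 , refl
  ∈Orbit-walk₁ x (suc n) =
    subst (_∈Orbit walk₂ (K₁ x) n) (K₁-involutive x) (K₁-∈Orbit (∈Orbit-walk₂ (K₁ x) n))

  ∈Orbit-walk₂ : ∀ x n → x ∈Orbit walk₂ x n
  ∈Orbit-walk₂ x zero    = 0 , refl
  ∈Orbit-walk₂ x (suc n) =
    subst (_∈Orbit walk₁ (K₂ x) n) (K₂-involutive x) (K₂-∈Orbit (∈Orbit-walk₁ (K₂ x) n))

∈Orbit-sym : ∀ {x y} → x ∈Orbit y → y ∈Orbit x
∈Orbit-sym {y = y} (n , refl) = ∈Orbit-walk₁ y n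

overlapping-orbits-coincide : ∀ x y z → z ∈Orbit x → z ∈Orbit y → ∀ w → (w ∈Orbit x) ⇔ (w ∈Orbit y)
overlapping-orbits-coincide x y z z∈x z∈y w =
  mk⇔ (λ w∈x → ∈Orbit-trans w∈x x∈y) (λ w∈y → ∈Orbit-trans w∈y (∈Orbit-sym x∈y))
  where
  x∈y : x ∈Orbit y
  x∈y = ∈Orbit-trans (∈Orbit-sym z∈x) z∈y

∈Orbit⇔∈arrangements : ∀ {u v w} → ZeroSum u v w → ∀ p →
                       p ∈Orbit corner u w ⇔ p ∈ arrangements corner u v w
∈Orbit⇔∈arrangements {u} {w = w} h p =
  subst (λ L → p ∈Orbit corner u w ⇔ p ∈ L) (cong (take 6) (walk₁-hexagon h)) (∈Orbit⇔∈orbitList (corner u w) p)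

orbit-enumeration : ∀ x → ∃[ L ] (Unique L × (∀ w → (w ∈Orbit x) ⇔ (w ∈ L))
                                  × (length L ≡ 1 ⊎ length L ≡ 3 ⊎ length L ≡ 6))
orbit-enumeration x with tripleView x
... | triple u v w h with arrangements-dedup corner ℤ._≟_ corner-injective u v w
...   | L , unique , same , size = L , unique , (λ p → same p ⇔-∘ ∈Orbit⇔∈arrangements h p) , size

spread : ℤ → ℤ → ℤ → ℕ
spread u v w = ∣ u - v ∣ +ℕ ∣ v - w ∣ +ℕ ∣ w - u ∣

-- A left fold, so that perimeter x is by definition pathLength (map (walk₁ x) (upTo 7)).
pathLength : List Point → ℕ
pathLength ps = foldl _+ℕ_ 0 (zipWith stepLength ps (drop 1 ps))

stepLength-horizontal : ∀ s s′ y → stepLength (s , y) (s′ , y) ≡ ∣ s - s′ ∣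
stepLength-horizontal s s′ y = begin
  ∣ s′ - s ∣ +ℕ ∣ y - y ∣  ≡⟨ cong₂ _+ℕ_ (∣i-j∣≡∣j-i∣ s′ s) (cong ∣_∣ (+-inverseʳ y)) ⟩
  ∣ s - s′ ∣ +ℕ 0         ≡⟨ ℕ.+-identityʳ _ ⟩
  ∣ s - s′ ∣              ∎

stepLength-vertical : ∀ x t t′ → stepLength (x , - t) (x , - t′) ≡ ∣ t - t′ ∣
stepLength-vertical x t t′ = begin
  ∣ x - x ∣ +ℕ ∣ - t′ - - t ∣
    ≡⟨ cong₂ _+ℕ_ (cong ∣_∣ (+-inverseʳ x)) (cong ∣_∣ (sym (neg-distrib-+ t′ (- t)))) ⟩
  ∣ - (t′ - t) ∣  ≡⟨ ∣-i∣≡∣i∣ (t′ - t) ⟩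
  ∣ t′ - t ∣      ≡⟨ ∣i-j∣≡∣j-i∣ t′ t ⟩
  ∣ t - t′ ∣      ∎

pathLength-hexagon : ∀ u v w → pathLength (hexagon u v w) ≡ 2 *ℕ spread u v w
pathLength-hexagon u v w = begin
  pathLength (hexagon u v w)
    ≡⟨ cong₂ _+ℕ_ (cong₂ _+ℕ_ (cong₂ _+ℕ_ (cong₂ _+ℕ_ (cong₂ _+ℕ_ (cong (0 +ℕ_)
         (stepLength-horizontal u v (- w))) (stepLength-vertical v w u))
         (stepLength-horizontal v w (- u))) (stepLength-vertical w u v))
         (stepLength-horizontal w u (- v))) (stepLength-vertical u v w) ⟩
  0 +ℕ d₁ +ℕ d₃ +ℕ d₂ +ℕ d₁ +ℕ d₃ +ℕ d₂  ≡⟨ twice d₁ d₂ d₃ ⟩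
  2 *ℕ spread u v w                    ∎
  where
  d₁ = ∣ u - v ∣
  d₂ = ∣ v - w ∣
  d₃ = ∣ w - u ∣
  twice : ∀ a b c → 0 +ℕ a +ℕ c +ℕ b +ℕ a +ℕ c +ℕ b ≡ 2 *ℕ (a +ℕ b +ℕ c)
  twice = ℕ-Solver.solve-∀

perimeter-corner : ∀ {u v w} → ZeroSum u v w → perimeter (corner u w) ≡ 2 *ℕ spread u v w
perimeter-corner {u} {v} {w} h = begin
  perimeter (corner u w)                          ≡⟨⟩
  pathLength (map (walk₁ (corner u w)) (upTo 7))  ≡⟨ cong pathLength (walk₁-hexagon h) ⟩
  pathLength (hexagon u v w)                      ≡⟨ pathLength-hexagon u v w ⟩
  2 *ℕ spread u v w                               ∎

+∣i-j∣≡j-i : ∀ {i j} → i ℤ.≤ j → + ∣ i - j ∣ ≡ j - i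
+∣i-j∣≡j-i {i} {j} i≤j = trans (cong +_ (∣i-j∣≡∣j-i∣ i j)) (0≤i⇒+∣i∣≡i (i≤j⇒0≤j-i i≤j))

+∣j-i∣≡j-i : ∀ {i j} → i ℤ.≤ j → + ∣ j - i ∣ ≡ j - i
+∣j-i∣≡j-i i≤j = 0≤i⇒+∣i∣≡i (i≤j⇒0≤j-i i≤j)

spread-sorted : ∀ {p q r} → p ℤ.≤ q → q ℤ.≤ r → + spread p q r ≡ (r - p) + (r - p)
spread-sorted {p} {q} {r} p≤q q≤r = begin
  + spread p q r
    ≡⟨ trans (pos-+ (d₁ +ℕ d₂) d₃) (cong (_+ + d₃) (pos-+ d₁ d₂)) ⟩
  + d₁ + + d₂ + + d₃
    ≡⟨ cong₂ _+_ (cong₂ _+_ (+∣i-j∣≡j-i p≤q) (+∣i-j∣≡j-i q≤r)) (+∣j-i∣≡j-i (≤-trans p≤q q≤r)) ⟩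
  (q - p) + (r - q) + (r - p)
    ≡⟨ telescope p q r ⟩
  (r - p) + (r - p) ∎
  where
  d₁ = ∣ p - q ∣
  d₂ = ∣ q - r ∣
  d₃ = ∣ r - p ∣
  telescope : ∀ p q r → (q - p) + (r - q) + (r - p) ≡ (r - p) + (r - p)
  telescope = ℤ-Solver.solve-∀

spread-rotate : ∀ u v w → spread u v w ≡ spread v w u
spread-rotate u v w = trans (ℕ.+-assoc ∣ u - v ∣ _ _) (ℕ.+-comm ∣ u - v ∣ _)

spread-reverse : ∀ u v w → spread u v w ≡ spread w v u
spread-reverse u v w = begin
  ∣ u - v ∣ +ℕ ∣ v - w ∣ +ℕ ∣ w - u ∣
    ≡⟨ cong₂ _+ℕ_ (cong₂ _+ℕ_ (∣i-j∣≡∣j-i∣ u v) (∣i-j∣≡∣j-i∣ v w)) (∣i-j∣≡∣j-i∣ w u) ⟩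
  ∣ v - u ∣ +ℕ ∣ w - v ∣ +ℕ ∣ u - w ∣
    ≡⟨ cong (_+ℕ ∣ u - w ∣) (ℕ.+-comm ∣ v - u ∣ _) ⟩
  ∣ w - v ∣ +ℕ ∣ v - u ∣ +ℕ ∣ u - w ∣ ∎

record Extremes (u v w : ℤ) : Set where
  constructor extremal
  field
    lo hi   : ℤ
    bounds  : All (λ s → lo ℤ.≤ s × s ℤ.≤ hi) (u ∷ v ∷ w ∷ [])
    lo∈     : lo ∈ u ∷ v ∷ w ∷ []
    hi∈     : hi ∈ u ∷ v ∷ w ∷ []
    spread≡ : + spread u v w ≡ (hi - lo) + (hi - lo)

extremes : ∀ u v w → Extremes u v w
extremes u v w with ≤-total u v | ≤-total v w | ≤-total w u
... | inj₁ u≤v | inj₁ v≤w | _ =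
  extremal u w ((≤-refl , u≤w) ∷ (u≤v , v≤w) ∷ (u≤w , ≤-refl) ∷ []) (here refl) (there (there (here refl)))
    (spread-sorted u≤v v≤w)
  where u≤w = ≤-trans u≤v v≤w
... | inj₁ u≤v | inj₂ w≤v | inj₁ w≤u =
  extremal w v ((w≤u , u≤v) ∷ (w≤v , ≤-refl) ∷ (≤-refl , w≤v) ∷ []) (there (there (here refl))) (there (here refl))
    (trans (cong +_ (trans (spread-rotate u v w) (spread-rotate v w u))) (spread-sorted w≤u u≤v))
... | inj₁ u≤v | inj₂ w≤v | inj₂ u≤w =
  extremal u v ((≤-refl , u≤v) ∷ (u≤v , ≤-refl) ∷ (u≤w , w≤v) ∷ []) (here refl) (there (here refl))
    (trans (cong +_ (trans (spread-reverse u v w) (trans (spread-rotate w v u) (spread-rotate v u w))))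
           (spread-sorted u≤w w≤v))
... | inj₂ v≤u | inj₁ v≤w | inj₁ w≤u =
  extremal v u ((v≤u , ≤-refl) ∷ (≤-refl , v≤u) ∷ (v≤w , w≤u) ∷ []) (there (here refl)) (here refl)
    (trans (cong +_ (spread-rotate u v w)) (spread-sorted v≤w w≤u))
... | inj₂ v≤u | inj₁ v≤w | inj₂ u≤w =
  extremal v w ((v≤u , u≤w) ∷ (≤-refl , v≤w) ∷ (v≤w , ≤-refl) ∷ []) (there (here refl)) (there (there (here refl)))
    (trans (cong +_ (trans (spread-reverse u v w) (spread-rotate w v u))) (spread-sorted v≤u u≤w))
... | inj₂ v≤u | inj₂ w≤v | _ =
  extremal w u ((w≤u , ≤-refl) ∷ (w≤v , v≤u) ∷ (≤-refl , w≤u) ∷ []) (there (there (here refl))) (here refl)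
    (trans (cong +_ (spread-reverse u v w)) (spread-sorted w≤v v≤u))
  where w≤u = ≤-trans w≤v v≤u

IsBoundingBox-resp-⇔ : ∀ {S T : Point → Set} {xmin xmax ymin ymax} → (∀ p → S p ⇔ T p) →
                       IsBoundingBox S xmin xmax ymin ymax → IsBoundingBox T xmin xmax ymin ymax
IsBoundingBox-resp-⇔ {S} {T} S⇔T (inBox , xmin , xmax , ymin , ymax) =
  (λ p → inBox p ∘ from (S⇔T p)) , move xmin , move xmax , move ymin , move ymax
  where
  move : ∀ {P : Point → Set} → ∃[ p ] (S p × P p) → ∃[ p ] (T p × P p)
  move (p , Sp , Pp) = p , to (S⇔T p) Sp , Pp

arrangements-boundingBox : ∀ {u v w} (e : Extremes u v w) → let open Extremes e in
                           IsBoundingBox (_∈ arrangements corner u v w) lo hi (- hi) (- lo)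
arrangements-boundingBox {u} {v} {w} e =
  (λ _ → All.lookup (arrangements-All corner inBox bounds)) ,
  attainedˡ lo∈ , attainedˡ hi∈ , attainedʳ hi∈ , attainedʳ lo∈
  where
  open Extremes e
  inBox : ∀ {s t} → lo ℤ.≤ s × s ℤ.≤ hi → lo ℤ.≤ t × t ℤ.≤ hi →
          (lo ℤ.≤ s × s ℤ.≤ hi) × (- hi ℤ.≤ - t × - t ℤ.≤ - lo)
  inBox s-bounds (lo≤t , t≤hi) = s-bounds , neg-mono-≤ t≤hi , neg-mono-≤ lo≤t
  attainedˡ : ∀ {s} → s ∈ u ∷ v ∷ w ∷ [] → ∃[ p ] (p ∈ arrangements corner u v w × proj₁ p ≡ s)
  attainedˡ s∈ = let t , st∈ = ∈-arrangementsˡ corner s∈ in corner _ t , st∈ , refl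
  attainedʳ : ∀ {t} → t ∈ u ∷ v ∷ w ∷ [] → ∃[ p ] (p ∈ arrangements corner u v w × proj₂ p ≡ - t)
  attainedʳ t∈ = let s , st∈ = ∈-arrangementsʳ corner t∈ in corner s _ , st∈ , refl

perimeter≡4*side : ∀ {u v w} → ZeroSum u v w → (e : Extremes u v w) → let open Extremes e in
                   + perimeter (corner u w) ≡ + 4 * (hi - lo)
perimeter≡4*side {u} {v} {w} h e = begin
  + perimeter (corner u w)       ≡⟨ cong +_ (perimeter-corner h) ⟩
  + (2 *ℕ spread u v w)          ≡⟨ pos-* 2 (spread u v w) ⟩
  + 2 * + spread u v w           ≡⟨ cong (+ 2 *_) spread≡ ⟩
  + 2 * ((hi - lo) + (hi - lo))  ≡⟨ double hi lo ⟩
  + 4 * (hi - lo)                ∎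
  where
  open Extremes e
  double : ∀ i j → + 2 * ((i - j) + (i - j)) ≡ + 4 * (i - j)
  double = ℤ-Solver.solve-∀

perimeter-divisible : ∀ x → ∃[ k ] perimeter x ≡ 4 *ℕ k
perimeter-divisible x with tripleView x
... | triple u v w h = ∣ hi - lo ∣ , (begin
  perimeter (corner u w)  ≡⟨ cong ∣_∣ (perimeter≡4*side h e) ⟩
  ∣ + 4 * (hi - lo) ∣     ≡⟨ abs-* (+ 4) (hi - lo) ⟩
  4 *ℕ ∣ hi - lo ∣        ∎)
  where
  e = extremes u v w
  open Extremes e

orbit-boundingSquare : ∀ x → ∃[ xmin ] ∃[ xmax ] ∃[ ymin ] ∃[ ymax ]
                         (IsBoundingBox (_∈Orbit x) xmin xmax ymin ymax
                          × xmax - xmin ≡ ymax - ymin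
                          × + 2 * ((xmax - xmin) + (ymax - ymin)) ≡ + perimeter x)
orbit-boundingSquare x with tripleView x
... | triple u v w h =
  lo , hi , - hi , - lo ,
  IsBoundingBox-resp-⇔ (λ p → ⇔-sym (∈Orbit⇔∈arrangements h p)) (arrangements-boundingBox e) ,
  square hi lo ,
  trans (doubleSquare hi lo) (sym (perimeter≡4*side h e))
  where
  e = extremes u v w
  open Extremes e
  square : ∀ i j → i - j ≡ - j - - i
  square = ℤ-Solver.solve-∀
  doubleSquare : ∀ i j → + 2 * ((i - j) + (- j - - i)) ≡ + 4 * (i - j)
  doubleSquare = ℤ-Solver.solve-∀

perimeter-axis : ∀ n → perimeter (-[1+ n ] , + 0) ≡ 8 *ℕ (1 +ℕ n)
perimeter-axis n = begin
  perimeter (corner -[1+ n ] (+ 0))                   ≡⟨ perimeter-corner zeroSum-axis ⟩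
  2 *ℕ spread -[1+ n ] (+ suc n) (+ 0)                ≡⟨⟩
  2 *ℕ ((2 +ℕ n +ℕ n) +ℕ (1 +ℕ n +ℕ 0) +ℕ (1 +ℕ n))  ≡⟨ eight n ⟩
  8 *ℕ (1 +ℕ n)                                       ∎
  where
  zeroSum-axis : ZeroSum -[1+ n ] (+ suc n) (+ 0)
  zeroSum-axis = zeroSum (cong (_+ + 0) (+-inverseˡ (+ suc n)))
  eight : ∀ n → 2 *ℕ ((2 +ℕ n +ℕ n) +ℕ (1 +ℕ n +ℕ 0) +ℕ (1 +ℕ n)) ≡ 8 *ℕ (1 +ℕ n)
  eight = ℕ-Solver.solve-∀

-- 8 (t + 1)³ = (d + 1)³ ≡ 1 (mod d) for d = 2 t + 1, so (t + 1)³ inverts 8 modulo d.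
perimeter-odd-residue : ∀ t r → ∃[ x ] ∃[ q ] perimeter x ≡ q *ℕ (1 +ℕ 2 *ℕ t) +ℕ r
perimeter-odd-residue t r =
  (-[1+ r *ℕ ((1 +ℕ t) *ℕ (1 +ℕ t) *ℕ (1 +ℕ t)) +ℕ 2 *ℕ t ] , + 0) ,
  r *ℕ ((1 +ℕ 2 *ℕ t) *ℕ (1 +ℕ 2 *ℕ t) +ℕ 3 *ℕ (1 +ℕ 2 *ℕ t) +ℕ 3) +ℕ 8 ,
  trans (perimeter-axis _) (inverse t r)
  where
  inverse : ∀ t r → 8 *ℕ (1 +ℕ (r *ℕ ((1 +ℕ t) *ℕ (1 +ℕ t) *ℕ (1 +ℕ t)) +ℕ 2 *ℕ t))
                    ≡ (r *ℕ ((1 +ℕ 2 *ℕ t) *ℕ (1 +ℕ 2 *ℕ t) +ℕ 3 *ℕ (1 +ℕ 2 *ℕ t) +ℕ 3) +ℕ 8)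
                      *ℕ (1 +ℕ 2 *ℕ t) +ℕ r
  inverse = ℕ-Solver.solve-∀

perimeter-residues : ∀ d → 3 ≤ d → d % 2 ≡ 1 → ∀ r → r < d → ∃[ x ] ∃[ q ] perimeter x ≡ q *ℕ d +ℕ r
perimeter-residues d _ d-odd r _ =
  subst (λ e → ∃[ x ] ∃[ q ] perimeter x ≡ q *ℕ e +ℕ r) (sym d≡1+2t) (perimeter-odd-residue (d / 2) r)
  where
  d≡1+2t : d ≡ 1 +ℕ 2 *ℕ (d / 2)
  d≡1+2t = trans (m≡m%n+[m/n]*n d 2) (cong₂ _+ℕ_ d-odd (ℕ.*-comm (d / 2) 2))

proposition7p1 :
    (∀ x → walk₁ x 6 ≡ x)
    × (∀ x → ∃[ L ] (Unique L × (∀ w → (w ∈Orbit x) ⇔ (w ∈ L))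
          × (length L ≡ 1 ⊎ length L ≡ 3 ⊎ length L ≡ 6)))
    × (∀ x → x ∈Orbit x)
    × (∀ x y z → z ∈Orbit x → z ∈Orbit y → ∀ w → (w ∈Orbit x) ⇔ (w ∈Orbit y))
    × (∀ x → ∃[ k ] perimeter x ≡ 4 *ℕ k)
    × (∀ d → 3 ≤ d → d % 2 ≡ 1 → ∀ r → r < d → ∃[ x ] ∃[ q ] perimeter x ≡ q *ℕ d +ℕ r)
    × (∀ x → ∃[ xmin ] ∃[ xmax ] ∃[ ymin ] ∃[ ymax ]
          (IsBoundingBox (_∈Orbit x) xmin xmax ymin ymax
           × xmax - xmin ≡ ymax - ymin
           × + 2 * ((xmax - xmin) + (ymax - ymin)) ≡ + perimeter x))
proposition7p1 =
    walk₁-period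
  , orbit-enumeration
  , (λ x → 0 , refl)
  , overlapping-orbits-coincide
  , perimeter-divisible
  , perimeter-residues
  , orbit-boundingSquare
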